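{- Let $f(x)\in\mathbb{Q}(x)$ be a rational function. Then the sequence $(f(p))_p$ is in the MHS algebra $\mathcal{M}$.
   Context: A composition is a finite list $\mathbf{s}=(s_1,\ldots,s_j)$ of positive integers, and $H_N(\mathbf{s})=\sum_{N\ge n_1>\cdots>n_j\ge1}\frac{1}{n_1^{s_1}\cdots n_j^{s_j}}$. Let $\mathbb{Q}_{p\to\infty}$ be the quotient of the ring of sequences $(a_p)_p\in\prod_p\mathbb{Q}_p$ (indexed by primes) with $v_p(a_p)$ bounded below, by the ideal of sequences with $v_p(a_p)\to\infty$; a quantity defined for all but finitely many $p$ gives an element. The MHS algebra $\mathcal{M}$ is the set of $(a_p)$ for which there exist rationals $c_i$, integers $b_i\to\infty$ and compositions $\mathbf{s}_i$ (the empty composition allowed, with $H_N(\emptyset)=1$), independent of $p$, such that for every integer $n$, $a_p\equiv\sum_{b_i<n}c_ip^{b_i}H_{p-1}(\mathbf{s}_i)\pmod{p^n}$ for all sufficiently large $p$. -}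

module Defs where

open import Data.Nat as ℕ using (ℕ; zero; suc; NonZero)
open import Data.Nat.Properties using (m^n≢0)
open import Data.Nat.Divisibility using (_∣_)
open import Data.Nat.Primality using (Prime; prime⇒nonZero)
open import Data.Integer as ℤ using (ℤ; +_; -[1+_])
open import Data.Rational as ℚ using (ℚ; 0ℚ; 1ℚ; _+_; _*_; _-_; _/_)
open import Data.List using (List; []; _∷_)
open import Data.List.Relation.Unary.All using (All)
open import Data.List.Relation.Unary.Any using (Any)
open import Data.Product using (Σ; ∃; _×_)
open import Data.Bool using (if_then_else_)
open import Relation.Nullary using (¬_; does)
open import Relation.Binary.PropositionalEquality using (_≡_; _≢_)

ℕ→ℚ : ℕ → ℚ
ℕ→ℚ n = (+ n) / 1

pow : (p : ℕ) → .{{NonZero p}} → ℤ → ℚ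
pow p (+ k) = ℕ→ℚ (p ℕ.^ k)
pow p -[1+ k ] = (+ 1) / (p ℕ.^ suc k)
  where instance _ = m^n≢0 p (suc k)

sumBelow : ℕ → (ℕ → ℚ) → ℚ
sumBelow zero    g = 0ℚ
sumBelow (suc N) g = sumBelow N g + g N

-- 1 / n^s for n ≥ 1 (n = suc k)
invPow : ℕ → ℕ → ℚ
invPow k s = (+ 1) / (suc k ℕ.^ s)
  where instance _ = m^n≢0 (suc k) s

Composition : List ℕ → Set
Composition s = All (λ k → 1 ℕ.≤ k) s

-- Multiple harmonic sum
--   H_N(s₁,…,s_j) = Σ_{N ≥ n₁ > ⋯ > n_j ≥ 1} 1/(n₁^{s₁}⋯n_j^{s_j}),
-- computed by the recursion H_N(∅) = 1 and
--   H_N(s₁ ∷ s') = Σ_{n=1}^{N} n^{-s₁} · H_{n-1}(s').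
H : ℕ → List ℕ → ℚ
H N []       = 1ℚ
H N (s ∷ ss) = sumBelow N (λ k → invPow k s * H k ss)

-- a ≡ b (mod p^n) in ℚ_p, i.e. v_p(a - b) ≥ n, for a prime p and n ∈ ℤ:
-- a - b = p^n · r with r a p-adic integer (p does not divide the denominator of r).
CongMod : (p : ℕ) → .{{NonZero p}} → ℤ → ℚ → ℚ → Set
CongMod p n a b = ∃ λ (r : ℚ) → (¬ (p ∣ ℚ.denominatorℕ r)) × (a - b ≡ pow p n * r)

-- Membership in the MHS algebra 𝓜 of a sequence (a_p)_p defined for primes p
-- satisfying a side condition D p (the quantity a_p being defined):
-- there exist c : ℕ → ℚ, b : ℕ → ℤ, compositions s : ℕ → List ℕ such that
-- for every integer n there is a cut-off N with b i ≥ n for all i ≥ N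
-- (so b i → ∞ and {i | b i < n} ⊆ {0,…,N-1}), and a bound P such that for
-- all primes p ≥ P (where a_p is defined)
--   a_p ≡ Σ_{b_i < n} c_i p^{b_i} H_{p-1}(s_i)  (mod p^n).
InMHS : (D : ℕ → Set) → ((p : ℕ) → Prime p → D p → ℚ) → Set
InMHS D a =
  Σ (ℕ → ℚ) λ c → Σ (ℕ → ℤ) λ b → Σ (ℕ → List ℕ) λ s →
    ((i : ℕ) → Composition (s i)) ×
    ((n : ℤ) → Σ ℕ λ N → Σ ℕ λ P →
       ((i : ℕ) → N ℕ.≤ i → n ℤ.≤ b i) ×
       ((p : ℕ) (pp : Prime p) → P ℕ.≤ p → (d : D p) →
          let instance _ = prime⇒nonZero pp in
          CongMod p n (a p pp d)
            (sumBelow N (λ i →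
               if does (b i ℤ.<? n)
               then c i * pow p (b i) * H (p ℕ.∸ 1) (s i)
               else 0ℚ))))

-- Polynomials over ℚ as coefficient lists (constant term first),
-- evaluated by Horner's rule.
Poly : Set
Poly = List ℚ

eval : Poly → ℚ → ℚ
eval []       x = 0ℚ
eval (a ∷ as) x = a + x * eval as x

NonZeroPoly : Poly → Set
NonZeroPoly q = Any (λ c → c ≢ 0ℚ) q

ratFunSeq : (P Q : Poly) → (p : ℕ) → Prime p → ℚ.NonZero (eval Q (ℕ→ℚ p)) → ℚ
ratFunSeq P Q p _ nz = ℚ._÷_ (eval P (ℕ→ℚ p)) (eval Q (ℕ→ℚ p)) {{nz}}

-- Write Q(x) = x^m Q₀(x) with Q₀(0) ≠ 0. Dividing P by Q₀ along increasing powers of x gives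
-- P = Q₀ · (c₀ + c₁ x + ⋯ + c_{N-1} x^{N-1}) + x^N R_N for every N, hence
--   f(p) = Σ_{i<N} c_i p^{i-m} + p^{N-m} R_N(p)/Q₀(p).
-- For p beyond the denominators of R_N and Q₀ and the numerator of Q₀(0), both R_N(p) and
-- 1/Q₀(p) are p-integral, so f(p) is congruent modulo p^{N-m} to a combination of powers of p,
-- i.e. of multiple harmonic sums of the empty composition.
module Submission where

open import Defs
open import Data.Nat as ℕ using (ℕ; zero; suc; _⊔_)
import Data.Nat.Properties as ℕP
open import Data.Nat.Divisibility as ℕD using (divides; >⇒∤)
open import Data.Nat.Coprimality as Coprimality using (coprime?; coprime-divisor)
open import Data.Nat.Primality using (Prime; euclidsLemma; prime⇒nonZero; prime⇒nonTrivial)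
open import Data.Integer as ℤ using (ℤ; +_; -[1+_])
import Data.Integer.Properties as ℤP
import Data.Integer.Divisibility.Signed as ℤD
open import Data.Rational as ℚ using (ℚ; mkℚ; 0ℚ; 1ℚ; _+_; _*_; _-_; _/_; 1/_; -_; NonZero)
import Data.Rational.Properties as ℚP
import Data.Rational.Unnormalised as ℚᵘ
import Data.Rational.Unnormalised.Properties as ℚᵘP
open import Data.Rational.Solver using (module +-*-Solver)
open import Data.List using ([]; _∷_; map)
open import Data.List.Relation.Unary.All using ([])
open import Data.List.Relation.Unary.Any using (here; there)
open import Data.Product using (Σ; _×_; _,_)
open import Data.Sum using (inj₁; inj₂)
open import Data.Bool using (if_then_else_)
open import Relation.Nullary using (¬_; yes; no; does; contradiction)
open import Relation.Nullary.Decidable using (recompute)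
open import Relation.Binary.PropositionalEquality

open +-*-Solver

fromℤ : ℤ → ℚ
fromℤ z = z / 1

private
  toℚᵘ-fromℤ : ∀ z → ℚ.toℚᵘ (fromℤ z) ℚᵘ.≃ ℚᵘ.mkℚᵘ z 0
  toℚᵘ-fromℤ z = ℚP.toℚᵘ-fromℚᵘ (ℚᵘ.mkℚᵘ z 0)

fromℤ-* : ∀ a b → fromℤ (a ℤ.* b) ≡ fromℤ a * fromℤ b
fromℤ-* a b = ℚP.toℚᵘ-injective (ℚᵘP.≃-trans (toℚᵘ-fromℤ (a ℤ.* b))
  (ℚᵘP.≃-sym (ℚᵘP.≃-trans (ℚP.toℚᵘ-homo-* (fromℤ a) (fromℤ b))
    (ℚᵘP.*-cong (toℚᵘ-fromℤ a) (toℚᵘ-fromℤ b)))))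

fromℤ-+ : ∀ a b → fromℤ (a ℤ.+ b) ≡ fromℤ a + fromℤ b
fromℤ-+ a b = ℚP.toℚᵘ-injective (ℚᵘP.≃-trans (toℚᵘ-fromℤ (a ℤ.+ b))
  (ℚᵘP.≃-sym (ℚᵘP.≃-trans (ℚP.toℚᵘ-homo-+ (fromℤ a) (fromℤ b))
    (ℚᵘP.≃-trans (ℚᵘP.+-cong (toℚᵘ-fromℤ a) (toℚᵘ-fromℤ b)) (ℚᵘ.*≡* identity)))))
  where
  identity : (a ℤ.* + 1 ℤ.+ b ℤ.* + 1) ℤ.* + 1 ≡ (a ℤ.+ b) ℤ.* + 1
  identity = trans (ℤP.*-identityʳ _)
    (trans (cong₂ ℤ._+_ (ℤP.*-identityʳ a) (ℤP.*-identityʳ b)) (sym (ℤP.*-identityʳ _)))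

ℕ→ℚ-* : ∀ a b → ℕ→ℚ (a ℕ.* b) ≡ ℕ→ℚ a * ℕ→ℚ b
ℕ→ℚ-* a b = trans (cong fromℤ (ℤP.pos-* a b)) (fromℤ-* (+ a) (+ b))

q*↧q≡↥q : ∀ q → q * fromℤ (ℚ.↧ q) ≡ fromℤ (ℚ.↥ q)
q*↧q≡↥q q@(mkℚ n d _) = ℚP.toℚᵘ-injective (ℚᵘP.≃-trans (ℚP.toℚᵘ-homo-* q (fromℤ (+ suc d)))
  (ℚᵘP.≃-trans (ℚᵘP.*-congˡ {ℚᵘ.mkℚᵘ n d} (toℚᵘ-fromℤ (+ suc d)))
    (ℚᵘP.≃-trans (ℚᵘ.*≡* cross) (ℚᵘP.≃-sym (toℚᵘ-fromℤ n)))))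
  where
  cross : (n ℤ.* + suc d) ℤ.* + 1 ≡ n ℤ.* + (suc d ℕ.* 1)
  cross = trans (ℤP.*-identityʳ _) (cong (λ k → n ℤ.* + k) (sym (ℕP.*-identityʳ (suc d))))

1/n*n≡1 : ∀ n .{{_ : ℕ.NonZero n}} → ((+ 1) / n) * ℕ→ℚ n ≡ 1ℚ
1/n*n≡1 (suc d) = ℚP.toℚᵘ-injective (ℚᵘP.≃-trans (ℚP.toℚᵘ-homo-* ((+ 1) / suc d) (ℕ→ℚ (suc d)))
  (ℚᵘP.≃-trans (ℚᵘP.*-cong (ℚP.toℚᵘ-fromℚᵘ (ℚᵘ.mkℚᵘ (+ 1) d)) (toℚᵘ-fromℤ (+ suc d))) (ℚᵘ.*≡* cross)))
  where
  cross : (+ 1 ℤ.* + suc d) ℤ.* + 1 ≡ + 1 ℤ.* + (suc d ℕ.* 1)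
  cross = trans (ℤP.*-identityʳ _) (cong (λ k → + 1 ℤ.* + k) (sym (ℕP.*-identityʳ (suc d))))

nonZero⇒≢0 : ∀ {q} → NonZero q → q ≢ 0ℚ
nonZero⇒≢0 nz refl with nz
... | ()

inverse-unique : ∀ a b c → a * b ≡ 1ℚ → a * c ≡ 1ℚ → b ≡ c
inverse-unique a b c ab≡1 ac≡1 = begin
  b           ≡⟨ sym (ℚP.*-identityʳ b) ⟩
  b * 1ℚ      ≡⟨ cong (b *_) (sym ac≡1) ⟩
  b * (a * c) ≡⟨ solve 3 (λ a b c → b :* (a :* c) := (a :* b) :* c) refl a b c ⟩
  (a * b) * c ≡⟨ cong (_* c) ab≡1 ⟩
  1ℚ * c      ≡⟨ ℚP.*-identityˡ c ⟩
  c           ∎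
  where open ≡-Reasoning

sumBelow-cong : ∀ N {f g} → (∀ i → i ℕ.< N → f i ≡ g i) → sumBelow N f ≡ sumBelow N g
sumBelow-cong zero    _   = refl
sumBelow-cong (suc N) f≡g =
  cong₂ _+_ (sumBelow-cong N (λ i i<N → f≡g i (ℕP.m<n⇒m<1+n i<N))) (f≡g N ℕP.≤-refl)

sumBelow-*ˡ : ∀ N y f → sumBelow N (λ i → y * f i) ≡ y * sumBelow N f
sumBelow-*ˡ zero    y f = sym (ℚP.*-zeroʳ y)
sumBelow-*ˡ (suc N) y f = trans (cong (_+ y * f N) (sumBelow-*ˡ N y f))
  (sym (ℚP.*-distribˡ-+ y (sumBelow N f) (f N)))

infixr 8 _^_
_^_ : ℚ → ℕ → ℚ
x ^ zero  = 1ℚ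
x ^ suc k = x ^ k * x

module _ (p : ℕ) .{{_ : ℕ.NonZero p}} where

  ℕ→ℚ-^ : ∀ k → ℕ→ℚ (p ℕ.^ k) ≡ ℕ→ℚ p ^ k
  ℕ→ℚ-^ zero    = refl
  ℕ→ℚ-^ (suc k) = trans (ℕ→ℚ-* p (p ℕ.^ k)) (trans (ℚP.*-comm (ℕ→ℚ p) _) (cong (_* ℕ→ℚ p) (ℕ→ℚ-^ k)))

  pow-suc : ∀ z → pow p (z ℤ.+ + 1) ≡ pow p z * ℕ→ℚ p
  pow-suc (+ j) = begin
    ℕ→ℚ (p ℕ.^ (j ℕ.+ 1)) ≡⟨ ℕ→ℚ-^ (j ℕ.+ 1) ⟩
    ℕ→ℚ p ^ (j ℕ.+ 1)     ≡⟨ cong (ℕ→ℚ p ^_) (ℕP.+-comm j 1) ⟩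
    ℕ→ℚ p ^ j * ℕ→ℚ p     ≡⟨ cong (_* ℕ→ℚ p) (sym (ℕ→ℚ-^ j)) ⟩
    ℕ→ℚ (p ℕ.^ j) * ℕ→ℚ p ∎
    where open ≡-Reasoning
  pow-suc -[1+ zero ] = sym (begin
    (+ 1 / (p ℕ.* 1)) * ℕ→ℚ p         ≡⟨ cong ((+ 1 / (p ℕ.* 1)) *_) (cong ℕ→ℚ (sym (ℕP.*-identityʳ p))) ⟩
    (+ 1 / (p ℕ.* 1)) * ℕ→ℚ (p ℕ.* 1) ≡⟨ 1/n*n≡1 (p ℕ.* 1) ⟩
    1ℚ                                ∎)
    where
    open ≡-Reasoning
    instance _ = ℕP.m^n≢0 p 1
  pow-suc -[1+ suc j ] = inverse-unique (ℕ→ℚ M) _ _ M*1/M≡1 M*[1/pM*p]≡1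
    where
    M = p ℕ.^ suc j
    instance
      _ = ℕP.m^n≢0 p (suc j)
      _ = ℕP.m^n≢0 p (suc (suc j))
    M*1/M≡1 : ℕ→ℚ M * (+ 1 / M) ≡ 1ℚ
    M*1/M≡1 = trans (ℚP.*-comm (ℕ→ℚ M) _) (1/n*n≡1 M)
    M*[1/pM*p]≡1 : ℕ→ℚ M * ((+ 1 / (p ℕ.* M)) * ℕ→ℚ p) ≡ 1ℚ
    M*[1/pM*p]≡1 = begin
      ℕ→ℚ M * ((+ 1 / (p ℕ.* M)) * ℕ→ℚ p) ≡⟨ solve 3 (λ m i p → m :* (i :* p) := i :* (p :* m)) refl
                                                (ℕ→ℚ M) (+ 1 / (p ℕ.* M)) (ℕ→ℚ p) ⟩
      (+ 1 / (p ℕ.* M)) * (ℕ→ℚ p * ℕ→ℚ M) ≡⟨ cong ((+ 1 / (p ℕ.* M)) *_) (sym (ℕ→ℚ-* p M)) ⟩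
      (+ 1 / (p ℕ.* M)) * ℕ→ℚ (p ℕ.* M)   ≡⟨ 1/n*n≡1 (p ℕ.* M) ⟩
      1ℚ                                   ∎
      where open ≡-Reasoning

  pow-+-^ : ∀ z k → pow p (z ℤ.+ + k) ≡ pow p z * ℕ→ℚ p ^ k
  pow-+-^ z zero    = trans (cong (pow p) (ℤP.+-identityʳ z)) (sym (ℚP.*-identityʳ _))
  pow-+-^ z (suc k) = begin
    pow p (z ℤ.+ + suc k)            ≡⟨ cong (λ t → pow p (z ℤ.+ + t)) (ℕP.+-comm 1 k) ⟩
    pow p (z ℤ.+ (+ k ℤ.+ + 1))      ≡⟨ cong (pow p) (sym (ℤP.+-assoc z (+ k) (+ 1))) ⟩
    pow p ((z ℤ.+ + k) ℤ.+ + 1)      ≡⟨ pow-suc (z ℤ.+ + k) ⟩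
    pow p (z ℤ.+ + k) * ℕ→ℚ p        ≡⟨ cong (_* ℕ→ℚ p) (pow-+-^ z k) ⟩
    pow p z * ℕ→ℚ p ^ k * ℕ→ℚ p      ≡⟨ ℚP.*-assoc (pow p z) _ (ℕ→ℚ p) ⟩
    pow p z * ℕ→ℚ p ^ suc k          ∎
    where open ≡-Reasoning

  pow-[-m]*^m≡1 : ∀ m → pow p (ℤ.- (+ m)) * ℕ→ℚ p ^ m ≡ 1ℚ
  pow-[-m]*^m≡1 m = trans (sym (pow-+-^ (ℤ.- (+ m)) m)) (cong (pow p) (ℤP.+-inverseˡ (+ m)))

infixr 7 _·ₚ_
infixl 6 _-ₚ_

_·ₚ_ : ℚ → Poly → Poly
c ·ₚ v = map (c *_) v

_-ₚ_ : Poly → Poly → Poly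
[]       -ₚ v        = (- 1ℚ) ·ₚ v
(x ∷ xs) -ₚ []       = x ∷ xs
(x ∷ xs) -ₚ (y ∷ ys) = (x - y) ∷ (xs -ₚ ys)

eval-·ₚ : ∀ c v X → eval (c ·ₚ v) X ≡ c * eval v X
eval-·ₚ c []       X = sym (ℚP.*-zeroʳ c)
eval-·ₚ c (y ∷ ys) X = begin
  c * y + X * eval (c ·ₚ ys) X ≡⟨ cong (λ t → c * y + X * t) (eval-·ₚ c ys X) ⟩
  c * y + X * (c * eval ys X)  ≡⟨ solve 4 (λ c y X e → c :* y :+ X :* (c :* e) := c :* (y :+ X :* e)) refl
                                    c y X (eval ys X) ⟩
  c * (y + X * eval ys X)      ∎
  where open ≡-Reasoning

eval--ₚ : ∀ u v X → eval (u -ₚ v) X ≡ eval u X - eval v X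
eval--ₚ []       v        X = trans (eval-·ₚ (- 1ℚ) v X)
  (solve 1 (λ e → :- con 1ℚ :* e := con 0ℚ :- e) refl (eval v X))
eval--ₚ (x ∷ xs) []       X = solve 1 (λ e → e := e :- con 0ℚ) refl (eval (x ∷ xs) X)
eval--ₚ (x ∷ xs) (y ∷ ys) X = begin
  (x - y) + X * eval (xs -ₚ ys) X           ≡⟨ cong (λ t → (x - y) + X * t) (eval--ₚ xs ys X) ⟩
  (x - y) + X * (eval xs X - eval ys X)     ≡⟨ solve 5 (λ x y X e f → (x :- y) :+ X :* (e :- f)
                                                         := (x :+ X :* e) :- (y :+ X :* f))
                                                  refl x y X (eval xs X) (eval ys X) ⟩
  (x + X * eval xs X) - (y + X * eval ys X) ∎
  where open ≡-Reasoning

factor-^ : ∀ Q → NonZeroPoly Q →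
  Σ ℕ λ m → Σ ℚ λ q0 → Σ Poly λ qs → q0 ≢ 0ℚ × (∀ X → eval Q X ≡ X ^ m * eval (q0 ∷ qs) X)
factor-^ (a ∷ Q) (here a≢0) = 0 , a , Q , a≢0 , λ X → sym (ℚP.*-identityˡ _)
factor-^ (a ∷ Q) (there nzQ) with a ℚP.≟ 0ℚ
... | no a≢0   = 0 , a , Q , a≢0 , λ X → sym (ℚP.*-identityˡ _)
... | yes refl with factor-^ Q nzQ
...   | m , q0 , qs , q0≢0 , Q≡ = suc m , q0 , qs , q0≢0 , λ X → begin
  0ℚ + X * eval Q X                  ≡⟨ cong (λ t → 0ℚ + X * t) (Q≡ X) ⟩
  0ℚ + X * (X ^ m * Q₀ X)            ≡⟨ solve 3 (λ X Xm e → con 0ℚ :+ X :* (Xm :* e) := (Xm :* X) :* e) refl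
                                          X (X ^ m) (Q₀ X) ⟩
  (X ^ m * X) * Q₀ X                 ∎
  where
  open ≡-Reasoning
  Q₀ : ℚ → ℚ
  Q₀ = eval (q0 ∷ qs)

module PowerSeriesDivision (q0 : ℚ) .{{_ : NonZero q0}} (qs : Poly) (P : Poly) where

  Q₀ : ℚ → ℚ
  Q₀ = eval (q0 ∷ qs)

  coeff : Poly → ℚ
  coeff []      = 0ℚ
  coeff (a ∷ _) = a * 1/ q0

  divStep : Poly → Poly
  divStep []       = []
  divStep (a ∷ as) = as -ₚ (a * 1/ q0) ·ₚ qs

  eval-divStep : ∀ R X → eval R X ≡ coeff R * Q₀ X + X * eval (divStep R) X
  eval-divStep []       X = solve 2 (λ X e → con 0ℚ := con 0ℚ :* e :+ X :* con 0ℚ) refl X (Q₀ X)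
  eval-divStep (a ∷ as) X = begin
    a + X * eval as X                                    ≡⟨ cong (λ t → t + X * eval as X) (sym a/q0*q0≡a) ⟩
    c * q0 + X * eval as X                               ≡⟨ solve 5 (λ c q X e t → c :* q :+ X :* e
                                                                := c :* (q :+ X :* t) :+ X :* (e :- c :* t))
                                                              refl c q0 X (eval as X) (eval qs X) ⟩
    c * Q₀ X + X * (eval as X - c * eval qs X)           ≡⟨ cong (λ t → c * Q₀ X + X * t) (sym (begin
      eval (as -ₚ c ·ₚ qs) X                                ≡⟨ eval--ₚ as (c ·ₚ qs) X ⟩
      eval as X - eval (c ·ₚ qs) X                          ≡⟨ cong (λ t → eval as X - t) (eval-·ₚ c qs X) ⟩
      eval as X - c * eval qs X                             ∎)) ⟩
    c * Q₀ X + X * eval (as -ₚ c ·ₚ qs) X                 ∎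
    where
    open ≡-Reasoning
    c = a * 1/ q0
    a/q0*q0≡a : c * q0 ≡ a
    a/q0*q0≡a = trans (ℚP.*-assoc a (1/ q0) q0) (trans (cong (a *_) (ℚP.*-inverseˡ q0)) (ℚP.*-identityʳ a))

  remainder : ℕ → Poly
  remainder zero    = P
  remainder (suc i) = divStep (remainder i)

  quotientCoeff : ℕ → ℚ
  quotientCoeff i = coeff (remainder i)

  quotient : ℕ → ℚ → ℚ
  quotient N X = sumBelow N (λ i → quotientCoeff i * X ^ i)

  eval-division : ∀ N X → eval P X ≡ Q₀ X * quotient N X + X ^ N * eval (remainder N) X
  eval-division zero    X = solve 2 (λ q e → e := q :* con 0ℚ :+ con 1ℚ :* e) refl (Q₀ X) (eval P X)
  eval-division (suc N) X = begin
    eval P X                                          ≡⟨ eval-division N X ⟩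
    Q₀ X * S + X ^ N * eval R X                       ≡⟨ cong (λ t → Q₀ X * S + X ^ N * t) (eval-divStep R X) ⟩
    Q₀ X * S + X ^ N * (c * Q₀ X + X * eval R′ X)     ≡⟨ solve 6 (λ q s xN c X r → q :* s :+ xN :* (c :* q :+ X :* r)
                                                                := q :* (s :+ c :* xN) :+ (xN :* X) :* r)
                                                           refl (Q₀ X) S (X ^ N) c X (eval R′ X) ⟩
    Q₀ X * quotient (suc N) X + X ^ suc N * eval R′ X ∎
    where
    open ≡-Reasoning
    S = quotient N X
    R = remainder N
    R′ = remainder (suc N)
    c = quotientCoeff N

maxDenominator : Poly → ℕ
maxDenominator []      = 0
maxDenominator (c ∷ L) = ℚ.↧ₙ c ⊔ maxDenominator L

module Integrality (p : ℕ) (pp : Prime p) where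

  -- Integrality at p is witnessed by clearing denominators with a multiplier prime to p,
  -- which makes closure under + and * immediate.
  Integral : ℚ → Set
  Integral r = Σ ℤ λ A → Σ ℤ λ B → ¬ (p ℕD.∣ ℤ.∣ A ∣) × (r * fromℤ A ≡ fromℤ B)

  p∤1 : ¬ (p ℕD.∣ 1)
  p∤1 = >⇒∤ (ℕ.nonTrivial⇒n>1 p {{prime⇒nonTrivial pp}})

  p∤*ℤ : ∀ a b → ¬ (p ℕD.∣ ℤ.∣ a ∣) → ¬ (p ℕD.∣ ℤ.∣ b ∣) → ¬ (p ℕD.∣ ℤ.∣ a ℤ.* b ∣)
  p∤*ℤ a b p∤a p∤b p∣ab with euclidsLemma ℤ.∣ a ∣ ℤ.∣ b ∣ pp (subst (p ℕD.∣_) (ℤP.abs-* a b) p∣ab)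
  ... | inj₁ p∣a = p∤a p∣a
  ... | inj₂ p∣b = p∤b p∣b

  integral⇒p∤↧ : ∀ r → Integral r → ¬ (p ℕD.∣ ℚ.↧ₙ r)
  integral⇒p∤↧ r@(mkℚ n d c) (A , B , p∤A , r*A≡B) p∣D = p∤A (ℕD.∣-trans p∣D D∣A)
    where
    D = suc d
    r*A≃B : ℚᵘ.mkℚᵘ n d ℚᵘ.* ℚᵘ.mkℚᵘ A 0 ℚᵘ.≃ ℚᵘ.mkℚᵘ B 0
    r*A≃B = ℚᵘP.≃-trans
      (ℚᵘP.≃-sym (ℚᵘP.≃-trans (ℚP.toℚᵘ-homo-* r (fromℤ A)) (ℚᵘP.*-congˡ {ℚᵘ.mkℚᵘ n d} (toℚᵘ-fromℤ A))))
      (ℚᵘP.≃-trans (ℚP.toℚᵘ-cong r*A≡B) (toℚᵘ-fromℤ B))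
    cross : (n ℤ.* A) ℤ.* + 1 ≡ B ℤ.* + (D ℕ.* 1)
    cross with r*A≃B
    ... | ℚᵘ.*≡* eq = eq
    ∣n∣*∣A∣≡∣B∣*D : ℤ.∣ n ∣ ℕ.* ℤ.∣ A ∣ ≡ ℤ.∣ B ∣ ℕ.* D
    ∣n∣*∣A∣≡∣B∣*D = begin
      ℤ.∣ n ∣ ℕ.* ℤ.∣ A ∣        ≡⟨ sym (ℤP.abs-* n A) ⟩
      ℤ.∣ n ℤ.* A ∣              ≡⟨ cong ℤ.∣_∣ (sym (ℤP.*-identityʳ (n ℤ.* A))) ⟩
      ℤ.∣ (n ℤ.* A) ℤ.* + 1 ∣    ≡⟨ cong ℤ.∣_∣ cross ⟩
      ℤ.∣ B ℤ.* + (D ℕ.* 1) ∣    ≡⟨ ℤP.abs-* B (+ (D ℕ.* 1)) ⟩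
      ℤ.∣ B ∣ ℕ.* (D ℕ.* 1)      ≡⟨ cong (ℤ.∣ B ∣ ℕ.*_) (ℕP.*-identityʳ D) ⟩
      ℤ.∣ B ∣ ℕ.* D              ∎
      where open ≡-Reasoning
    D∣A : D ℕD.∣ ℤ.∣ A ∣
    D∣A = coprime-divisor (Coprimality.sym (recompute (coprime? ℤ.∣ n ∣ D) c)) (divides ℤ.∣ B ∣ ∣n∣*∣A∣≡∣B∣*D)

  integral-fromℤ : ∀ z → Integral (fromℤ z)
  integral-fromℤ z = + 1 , z , p∤1 , ℚP.*-identityʳ (fromℤ z)

  integral-* : ∀ {r s} → Integral r → Integral s → Integral (r * s)
  integral-* {r} {s} (A₁ , B₁ , p∤A₁ , r*A₁≡B₁) (A₂ , B₂ , p∤A₂ , s*A₂≡B₂) =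
    A₁ ℤ.* A₂ , B₁ ℤ.* B₂ , p∤*ℤ A₁ A₂ p∤A₁ p∤A₂ , (begin
      r * s * fromℤ (A₁ ℤ.* A₂)                ≡⟨ cong (r * s *_) (fromℤ-* A₁ A₂) ⟩
      r * s * (fromℤ A₁ * fromℤ A₂)            ≡⟨ solve 4 (λ r s a b → r :* s :* (a :* b) := (r :* a) :* (s :* b))
                                                     refl r s (fromℤ A₁) (fromℤ A₂) ⟩
      (r * fromℤ A₁) * (s * fromℤ A₂)          ≡⟨ cong₂ _*_ r*A₁≡B₁ s*A₂≡B₂ ⟩
      fromℤ B₁ * fromℤ B₂                      ≡⟨ sym (fromℤ-* B₁ B₂) ⟩
      fromℤ (B₁ ℤ.* B₂)                        ∎)
    where open ≡-Reasoning

  integral-+ : ∀ {r s} → Integral r → Integral s → Integral (r + s)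
  integral-+ {r} {s} (A₁ , B₁ , p∤A₁ , r*A₁≡B₁) (A₂ , B₂ , p∤A₂ , s*A₂≡B₂) =
    A₁ ℤ.* A₂ , B₁ ℤ.* A₂ ℤ.+ B₂ ℤ.* A₁ , p∤*ℤ A₁ A₂ p∤A₁ p∤A₂ , (begin
      (r + s) * fromℤ (A₁ ℤ.* A₂)                          ≡⟨ cong ((r + s) *_) (fromℤ-* A₁ A₂) ⟩
      (r + s) * (fromℤ A₁ * fromℤ A₂)                      ≡⟨ solve 4 (λ r s a b → (r :+ s) :* (a :* b)
                                                                 := (r :* a) :* b :+ (s :* b) :* a)
                                                               refl r s (fromℤ A₁) (fromℤ A₂) ⟩
      (r * fromℤ A₁) * fromℤ A₂ + (s * fromℤ A₂) * fromℤ A₁ ≡⟨ cong₂ (λ u v → u * fromℤ A₂ + v * fromℤ A₁)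
                                                               r*A₁≡B₁ s*A₂≡B₂ ⟩
      fromℤ B₁ * fromℤ A₂ + fromℤ B₂ * fromℤ A₁            ≡⟨ sym (cong₂ _+_ (fromℤ-* B₁ A₂) (fromℤ-* B₂ A₁)) ⟩
      fromℤ (B₁ ℤ.* A₂) + fromℤ (B₂ ℤ.* A₁)                ≡⟨ sym (fromℤ-+ (B₁ ℤ.* A₂) (B₂ ℤ.* A₁)) ⟩
      fromℤ (B₁ ℤ.* A₂ ℤ.+ B₂ ℤ.* A₁)                      ∎)
    where open ≡-Reasoning

  integral-^ : ∀ {r} k → Integral r → Integral (r ^ k)
  integral-^ zero    _  = integral-fromℤ (+ 1)
  integral-^ {r} (suc k) ir = integral-* {r ^ k} {r} (integral-^ k ir) ir

  integral-↧<p : ∀ q → ℚ.↧ₙ q ℕ.< p → Integral q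
  integral-↧<p q@(mkℚ _ _ _) ↧q<p = ℚ.↧ q , ℚ.↥ q , >⇒∤ ↧q<p , q*↧q≡↥q q

  integral-eval : ∀ L {x} → maxDenominator L ℕ.< p → Integral x → Integral (eval L x)
  integral-eval []      _ _  = integral-fromℤ (+ 0)
  integral-eval (c ∷ L) {x} bound ix = integral-+ {c} {x * eval L x}
    (integral-↧<p c (ℕP.m⊔n<o⇒m<o _ (maxDenominator L) bound))
    (integral-* {x} {eval L x} ix (integral-eval L {x} (ℕP.m⊔n<o⇒n<o (ℚ.↧ₙ c) _ bound) ix))

  -- The witness comes from (a + p r) · ↧a · A = ↥a · A + p · B · ↧a, which is prime to p
  -- whenever ↥a is.
  integral-1/ : ∀ a {r} → ¬ (p ℕD.∣ ℤ.∣ ℚ.↥ a ∣) → Integral r →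
                .{{_ : NonZero (a + ℕ→ℚ p * r)}} → Integral (1/ (a + ℕ→ℚ p * r))
  integral-1/ a {r} p∤↥a (A , B , p∤A , r*A≡B) = K , d ℤ.* A , p∤K , (begin
    1/ u * fromℤ K                  ≡⟨ cong (1/ u *_) K≡u*d*A ⟩
    1/ u * (u * fromℤ (d ℤ.* A))    ≡⟨ sym (ℚP.*-assoc (1/ u) u _) ⟩
    (1/ u * u) * fromℤ (d ℤ.* A)    ≡⟨ cong (_* fromℤ (d ℤ.* A)) (ℚP.*-inverseˡ u) ⟩
    1ℚ * fromℤ (d ℤ.* A)            ≡⟨ ℚP.*-identityˡ _ ⟩
    fromℤ (d ℤ.* A)                 ∎)
    where
    open ≡-Reasoning
    u = a + ℕ→ℚ p * r
    d = ℚ.↧ a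
    n = ℚ.↥ a
    K = n ℤ.* A ℤ.+ + p ℤ.* (B ℤ.* d)
    K≡u*d*A : fromℤ K ≡ u * fromℤ (d ℤ.* A)
    K≡u*d*A = begin
      fromℤ K                                                    ≡⟨ fromℤ-+ (n ℤ.* A) (+ p ℤ.* (B ℤ.* d)) ⟩
      fromℤ (n ℤ.* A) + fromℤ (+ p ℤ.* (B ℤ.* d))               ≡⟨ cong₂ _+_ (fromℤ-* n A)
                                                                      (trans (fromℤ-* (+ p) (B ℤ.* d))
                                                                             (cong (ℕ→ℚ p *_) (fromℤ-* B d))) ⟩
      fromℤ n * fromℤ A + ℕ→ℚ p * (fromℤ B * fromℤ d)           ≡⟨ cong₂ (λ x y → x * fromℤ A + ℕ→ℚ p * (y * fromℤ d))
                                                                      (sym (q*↧q≡↥q a)) (sym r*A≡B) ⟩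
      (a * fromℤ d) * fromℤ A + ℕ→ℚ p * ((r * fromℤ A) * fromℤ d) ≡⟨ solve 5 (λ a d A p r → (a :* d) :* A :+ p :* ((r :* A) :* d)
                                                                        := (a :+ p :* r) :* (d :* A))
                                                                      refl a (fromℤ d) (fromℤ A) (ℕ→ℚ p) r ⟩
      u * (fromℤ d * fromℤ A)                                    ≡⟨ cong (u *_) (sym (fromℤ-* d A)) ⟩
      u * fromℤ (d ℤ.* A)                                        ∎
    p∤K : ¬ (p ℕD.∣ ℤ.∣ K ∣)
    p∤K p∣K = p∤*ℤ n A p∤↥a p∤A (ℤD.∣⇒∣ᵤ (ℤD.∣m+n∣n⇒∣m {+ p} {n ℤ.* A} {+ p ℤ.* (B ℤ.* d)}
      (ℤD.∣ᵤ⇒∣ {+ p} {K} p∣K) (ℤD.∣m⇒∣m*n (B ℤ.* d) ℤD.∣-refl)))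

ℕ-ceiling : ∀ k → Σ ℕ λ N → Σ ℕ λ e →
  (+ N ≡ k ℤ.+ + e) × (∀ i → N ℕ.≤ i → k ℤ.≤ + i) × (∀ i → i ℕ.< N → + i ℤ.< k)
ℕ-ceiling (+ t)    = t , 0 , sym (ℤP.+-identityʳ (+ t)) , (λ _ → ℤ.+≤+) , (λ _ → ℤ.+<+)
ℕ-ceiling -[1+ t ] = 0 , suc t , sym (ℤP.+-inverseˡ (+ suc t)) , (λ _ _ → ℤ.-≤+) , (λ _ ())

-m+[k+m]≡k : ∀ k m → ℤ.- m ℤ.+ (k ℤ.+ m) ≡ k
-m+[k+m]≡k k m = begin
  ℤ.- m ℤ.+ (k ℤ.+ m)   ≡⟨ cong (λ t → ℤ.- m ℤ.+ t) (ℤP.+-comm k m) ⟩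
  ℤ.- m ℤ.+ (m ℤ.+ k)   ≡⟨ sym (ℤP.+-assoc (ℤ.- m) m k) ⟩
  (ℤ.- m ℤ.+ m) ℤ.+ k   ≡⟨ cong (ℤ._+ k) (ℤP.+-inverseˡ m) ⟩
  + 0 ℤ.+ k             ≡⟨ ℤP.+-identityˡ k ⟩
  k                     ∎
  where open ≡-Reasoning

module RationalFunctionExpansion (P Q : Poly) (m : ℕ) (q0 : ℚ) (qs : Poly)
  (q0≢0 : q0 ≢ 0ℚ) (Q≡ : ∀ X → eval Q X ≡ X ^ m * eval (q0 ∷ qs) X) where

  instance
    q0-nonZero : NonZero q0
    q0-nonZero = ℚ.≢-nonZero q0≢0

  open PowerSeriesDivision q0 qs P public

  exponent : ℕ → ℤ
  exponent i = ℤ.- (+ m) ℤ.+ + i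

  cutoff : ∀ n → Σ ℕ λ N → Σ ℕ λ e →
    (exponent N ≡ n ℤ.+ + e) × (∀ i → N ℕ.≤ i → n ℤ.≤ exponent i) × (∀ i → i ℕ.< N → exponent i ℤ.< n)
  cutoff n with ℕ-ceiling (n ℤ.+ + m)
  ... | N , e , N≡ , above , below = N , e , exponent-N , exponent-above , exponent-below
    where
    -m+[n+m]≡n = -m+[k+m]≡k n (+ m)
    exponent-N : exponent N ≡ n ℤ.+ + e
    exponent-N = begin
      ℤ.- (+ m) ℤ.+ + N                      ≡⟨ cong (λ t → ℤ.- (+ m) ℤ.+ t) N≡ ⟩
      ℤ.- (+ m) ℤ.+ ((n ℤ.+ + m) ℤ.+ + e)    ≡⟨ sym (ℤP.+-assoc (ℤ.- (+ m)) (n ℤ.+ + m) (+ e)) ⟩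
      ℤ.- (+ m) ℤ.+ (n ℤ.+ + m) ℤ.+ + e      ≡⟨ cong (ℤ._+ + e) -m+[n+m]≡n ⟩
      n ℤ.+ + e                              ∎
      where open ≡-Reasoning
    exponent-above : ∀ i → N ℕ.≤ i → n ℤ.≤ exponent i
    exponent-above i N≤i = subst (ℤ._≤ exponent i) -m+[n+m]≡n (ℤP.+-monoʳ-≤ (ℤ.- (+ m)) (above i N≤i))
    exponent-below : ∀ i → i ℕ.< N → exponent i ℤ.< n
    exponent-below i i<N = subst (exponent i ℤ.<_) -m+[n+m]≡n (ℤP.+-monoʳ-< (ℤ.- (+ m)) (below i i<N))

  bound : ℕ → ℕ
  bound N = maxDenominator (remainder N) ⊔ maxDenominator qs ⊔ ℤ.∣ ℚ.↥ q0 ∣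

  Q₀-nonZero : ∀ X → NonZero (eval Q X) → NonZero (Q₀ X)
  Q₀-nonZero X QX≢0 = ℚ.≢-nonZero λ Q₀X≡0 →
    nonZero⇒≢0 QX≢0 (trans (Q≡ X) (trans (cong (X ^ m *_) Q₀X≡0) (ℚP.*-zeroʳ (X ^ m))))

  ratFun-expansion : ∀ N X Y .{{_ : NonZero (eval Q X)}} .{{_ : NonZero (Q₀ X)}} → Y * X ^ m ≡ 1ℚ →
    eval P X * 1/ eval Q X - Y * quotient N X ≡ Y * X ^ N * (eval (remainder N) X * 1/ Q₀ X)
  ratFun-expansion N X Y Y*X^m≡1 = begin
    eval P X * 1/ eval Q X - Y * S                 ≡⟨ cong (λ u → eval P X * u - Y * S) 1/Q≡Y*1/Q₀ ⟩
    eval P X * (Y * 1/ Q₀ X) - Y * S               ≡⟨ cong (λ t → t * (Y * 1/ Q₀ X) - Y * S) (eval-division N X) ⟩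
    (Q₀ X * S + X ^ N * R) * (Y * 1/ Q₀ X) - Y * S ≡⟨ solve 6 (λ q s xN r y i → (q :* s :+ xN :* r) :* (y :* i) :- y :* s
                                                            := y :* s :* (q :* i) :- y :* s :+ y :* xN :* (r :* i))
                                                         refl (Q₀ X) S (X ^ N) R Y (1/ Q₀ X) ⟩
    Y * S * (Q₀ X * 1/ Q₀ X) - Y * S + Y * X ^ N * (R * 1/ Q₀ X) ≡⟨ cong (λ t → Y * S * t - Y * S + Y * X ^ N * (R * 1/ Q₀ X))
                                                                       (ℚP.*-inverseʳ (Q₀ X)) ⟩
    Y * S * 1ℚ - Y * S + Y * X ^ N * (R * 1/ Q₀ X) ≡⟨ solve 2 (λ s t → s :* con 1ℚ :- s :+ t := t) refl (Y * S) _ ⟩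
    Y * X ^ N * (R * 1/ Q₀ X)                      ∎
    where
    open ≡-Reasoning
    S = quotient N X
    R = eval (remainder N) X
    1/Q≡Y*1/Q₀ : 1/ eval Q X ≡ Y * 1/ Q₀ X
    1/Q≡Y*1/Q₀ = inverse-unique (eval Q X) _ _ (ℚP.*-inverseʳ (eval Q X)) (begin
      eval Q X * (Y * 1/ Q₀ X)            ≡⟨ cong (_* (Y * 1/ Q₀ X)) (Q≡ X) ⟩
      X ^ m * Q₀ X * (Y * 1/ Q₀ X)        ≡⟨ solve 4 (λ a b c d → a :* b :* (c :* d) := (c :* a) :* (b :* d)) refl
                                               (X ^ m) (Q₀ X) Y (1/ Q₀ X) ⟩
      (Y * X ^ m) * (Q₀ X * 1/ Q₀ X)      ≡⟨ cong₂ _*_ Y*X^m≡1 (ℚP.*-inverseʳ (Q₀ X)) ⟩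
      1ℚ * 1ℚ                             ≡⟨ ℚP.*-identityˡ 1ℚ ⟩
      1ℚ                                  ∎)

  module _ (p : ℕ) (pp : Prime p) where

    private instance
      p-nonZero : ℕ.NonZero p
      p-nonZero = prime⇒nonZero pp

    open Integrality p pp

    truncation : ℤ → ℕ → ℚ
    truncation n N = sumBelow N (λ i →
      if does (exponent i ℤ.<? n) then quotientCoeff i * pow p (exponent i) * H (p ℕ.∸ 1) [] else 0ℚ)

    truncation≡ : ∀ n N → (∀ i → i ℕ.< N → exponent i ℤ.< n) →
      truncation n N ≡ pow p (ℤ.- (+ m)) * quotient N (ℕ→ℚ p)
    truncation≡ n N below = trans (sumBelow-cong N term≡) (sumBelow-*ˡ N (pow p (ℤ.- (+ m))) _)
      where
      term≡ : ∀ i → i ℕ.< N →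
        (if does (exponent i ℤ.<? n) then quotientCoeff i * pow p (exponent i) * 1ℚ else 0ℚ)
          ≡ pow p (ℤ.- (+ m)) * (quotientCoeff i * ℕ→ℚ p ^ i)
      term≡ i i<N with exponent i ℤ.<? n
      ... | no  i≮n = contradiction (below i i<N) i≮n
      ... | yes _   = begin
        quotientCoeff i * pow p (exponent i) * 1ℚ                ≡⟨ cong (λ t → quotientCoeff i * t * 1ℚ) (pow-+-^ p (ℤ.- (+ m)) i) ⟩
        quotientCoeff i * (pow p (ℤ.- (+ m)) * ℕ→ℚ p ^ i) * 1ℚ  ≡⟨ solve 3 (λ c y x → c :* (y :* x) :* con 1ℚ := y :* (c :* x))
                                                                      refl (quotientCoeff i) (pow p (ℤ.- (+ m))) (ℕ→ℚ p ^ i) ⟩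
        pow p (ℤ.- (+ m)) * (quotientCoeff i * ℕ→ℚ p ^ i)       ∎
        where open ≡-Reasoning

    integral-tail : ∀ N e → bound N ℕ.< p → .{{_ : NonZero (Q₀ (ℕ→ℚ p))}} →
      Integral (ℕ→ℚ p ^ e * (eval (remainder N) (ℕ→ℚ p) * 1/ Q₀ (ℕ→ℚ p)))
    integral-tail N e bound<p =
      integral-* {X ^ e} {R * 1/ Q₀ X} (integral-^ e integral-X)
        (integral-* {R} {1/ Q₀ X} (integral-eval (remainder N) {X} remainder<p integral-X)
          (integral-1/ q0 {eval qs X} p∤↥q0 (integral-eval qs {X} qs<p integral-X)))
      where
      X = ℕ→ℚ p
      R = eval (remainder N) X
      integral-X : Integral X
      integral-X = integral-fromℤ (+ p)
      denominators<p : maxDenominator (remainder N) ⊔ maxDenominator qs ℕ.< p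
      denominators<p = ℕP.m⊔n<o⇒m<o _ (ℤ.∣ ℚ.↥ q0 ∣) bound<p
      remainder<p : maxDenominator (remainder N) ℕ.< p
      remainder<p = ℕP.m⊔n<o⇒m<o _ (maxDenominator qs) denominators<p
      qs<p : maxDenominator qs ℕ.< p
      qs<p = ℕP.m⊔n<o⇒n<o (maxDenominator (remainder N)) _ denominators<p
      p∤↥q0 : ¬ (p ℕD.∣ ℤ.∣ ℚ.↥ q0 ∣)
      p∤↥q0 = >⇒∤ {{ℕ.≢-nonZero (λ ∣↥q0∣≡0 → q0≢0 (ℚP.↥p≡0⇒p≡0 q0 (ℤP.∣i∣≡0⇒i≡0 ∣↥q0∣≡0)))}}
                  (ℕP.m⊔n<o⇒n<o _ _ bound<p)

    congruence : ∀ n N e → exponent N ≡ n ℤ.+ + e → (∀ i → i ℕ.< N → exponent i ℤ.< n) →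
      bound N ℕ.< p → (d : NonZero (eval Q (ℕ→ℚ p))) →
      CongMod p n (ratFunSeq P Q p pp d) (truncation n N)
    congruence n N e exponent-N below bound<p d = r , integral⇒p∤↧ r (integral-tail N e bound<p) , (begin
      eval P X * 1/ eval Q X - truncation n N    ≡⟨ cong (λ t → eval P X * 1/ eval Q X - t) (truncation≡ n N below) ⟩
      eval P X * 1/ eval Q X - Y * quotient N X  ≡⟨ ratFun-expansion N X Y (pow-[-m]*^m≡1 p m) ⟩
      Y * X ^ N * (R * 1/ Q₀ X)                  ≡⟨ cong (_* (R * 1/ Q₀ X)) Y*X^N≡p^n*X^e ⟩
      pow p n * X ^ e * (R * 1/ Q₀ X)            ≡⟨ ℚP.*-assoc (pow p n) (X ^ e) _ ⟩
      pow p n * r                                ∎)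
      where
      open ≡-Reasoning
      X = ℕ→ℚ p
      Y = pow p (ℤ.- (+ m))
      R = eval (remainder N) X
      instance
        _ = d
        _ = Q₀-nonZero X d
      r = X ^ e * (R * 1/ Q₀ X)
      Y*X^N≡p^n*X^e : Y * X ^ N ≡ pow p n * X ^ e
      Y*X^N≡p^n*X^e = trans (sym (pow-+-^ p (ℤ.- (+ m)) N)) (trans (cong (pow p) exponent-N) (pow-+-^ p n e))

proposition4 : (P Q : Poly) → NonZeroPoly Q →
    InMHS (λ p → NonZero (eval Q (ℕ→ℚ p))) (ratFunSeq P Q)
proposition4 P Q nzQ with factor-^ Q nzQ
... | m , q0 , qs , q0≢0 , Q≡ = quotientCoeff , exponent , (λ _ → []) , (λ _ → []) , λ n →
  let N , e , exponent-N , above , below = cutoff n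
  in  N , suc (bound N) , above , λ p pp bound<p → congruence p pp n N e exponent-N below bound<p
  where open RationalFunctionExpansion P Q m q0 qs q0≢0 Q≡
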